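{- Let $g$ be a convex geometry on a finite set $I$. Then $\varphi_I(g)$ equals the number of totally convex sets in $g$, and $\varphi'_I(g)=2^{\mathrm{ex}(g)}$.
   Context: A convex geometry on finite $I$ is $g:2^I\to2^I$ with $A\subseteq g(A)$, $g(g(A))=g(A)$, monotone, $g(\emptyset)=\emptyset$, and anti-exchange (if $a\ne b$, $a,b\notin g(A)$, $a\in g(A\cup\{b\})$ then $b\notin g(A\cup\{a\})$). Convex sets: $g(K)=K$. For convex $S$: $g|_S(A)=g(A)$ for $A\subseteq S$, $g/_S(B)=g(S\cup B)\cap(I\setminus S)$ for $B\subseteq I\setminus S$. Characters (values in a field of characteristic $\neq2$): $\eta_I(g)=1$; $\zeta_I(g)=1$ if $g$ is discrete ($g(A)=A$ for all $A$) and $0$ otherwise; convolution $(\psi*\psi')_I(g)=\sum_{S\sqcup T=I,\ S\text{ convex}}\psi_S(g|_S)\psi'_T(g/_S)$; $\varphi=\zeta*\eta$, $\varphi'=\eta*\zeta$. A subset $S\subseteq I$ is totally convex if $g(A)=A$ for all $A\subseteq S$. $\mathrm{Ex}(g)=\{x\in I: g(I\setminus\{x\})=I\setminus\{x\}\}$ and $\mathrm{ex}(g)=|\mathrm{Ex}(g)|$. -}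

module Defs where

open import Level using (Level)
open import Data.Nat as ℕ using (ℕ; zero; suc; _^_)
open import Data.Bool using (Bool; true; false)
open import Data.Bool.Properties renaming (_≟_ to _≟ᵇ_)
open import Data.Fin using (Fin)
open import Data.Fin.Subset using (Subset; _⊆_; _∪_; _∩_; ∁; ⁅_⁆; _∈_; _∉_; ⊤; ⊥)
open import Data.Fin.Subset.Properties using (_⊆?_)
open import Data.List using (List; []; _∷_; map; concatMap; filter; length; allFin)
open import Data.List.Relation.Unary.All using (all?)
open import Data.Vec using (Vec; []; _∷_)
open import Data.Vec.Properties using (≡-dec)
open import Data.Product using (Σ; _×_)
open import Relation.Binary.PropositionalEquality using (_≡_; _≢_)
open import Relation.Nullary using (¬_; Dec; yes; no)
open import Relation.Nullary.Decidable using (⌊_⌋; _→-dec_)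
open import Algebra.Bundles using (CommutativeRing)

_≟ˢ_ : ∀ {n} (A B : Subset n) → Dec (A ≡ B)
_≟ˢ_ = ≡-dec _≟ᵇ_

allSubsets : (n : ℕ) → List (Subset n)
allSubsets zero    = [] ∷ []
allSubsets (suc n) = concatMap (λ A → (false ∷ A) ∷ (true ∷ A) ∷ []) (allSubsets n)

record IsConvexGeometry {n : ℕ} (g : Subset n → Subset n) : Set where
  field
    extensive    : ∀ A → A ⊆ g A
    idempotent   : ∀ A → g (g A) ≡ g A
    monotone     : ∀ A B → A ⊆ B → g A ⊆ g B
    empty        : g ⊥ ≡ ⊥
    antiExchange : ∀ A a b → a ≢ b → a ∉ g A → b ∉ g A →
                   a ∈ g (A ∪ ⁅ b ⁆) → b ∉ g (A ∪ ⁅ a ⁆)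

convex? : ∀ {n} (g : Subset n → Subset n) (K : Subset n) → Dec (g K ≡ K)
convex? g K = g K ≟ˢ K

TotallyConvex : ∀ {n} (g : Subset n → Subset n) (S : Subset n) → Set
TotallyConvex g S = ∀ A → A ⊆ S → g A ≡ A

totallyConvex? : ∀ {n} (g : Subset n → Subset n) (S : Subset n) → Dec (Data.List.Relation.Unary.All.All (λ A → A ⊆ S → g A ≡ A) (allSubsets n))
totallyConvex? {n} g S = all? (λ A → (A ⊆? S) →-dec (g A ≟ˢ A)) (allSubsets n)

numTotallyConvex : ∀ {n} (g : Subset n → Subset n) → ℕ
numTotallyConvex {n} g = length (filter (totallyConvex? g) (allSubsets n))

ex : ∀ {n} (g : Subset n → Subset n) → ℕ
ex {n} g = length (filter (λ x → g (∁ ⁅ x ⁆) ≟ˢ ∁ ⁅ x ⁆) (allFin n))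

-- Minors.  A convex geometry on a subset X ⊆ Fin n is represented by an
-- operator Subset n → Subset n, only its values on subsets of X matter.

restrict : ∀ {n} (g : Subset n → Subset n) (S : Subset n) → Subset n → Subset n
restrict g S A = g A

contract : ∀ {n} (g : Subset n → Subset n) (S : Subset n) → Subset n → Subset n
contract g S B = g (S ∪ B) ∩ ∁ S

module Characters {c ℓ : Level} (R : CommutativeRing c ℓ) where
  open CommutativeRing R

  -- a character: ground set X ⊆ Fin n, geometry on X ↦ value in R
  Character : ℕ → Set c
  Character n = (X : Subset n) → (Subset n → Subset n) → Carrier

  sumR : List Carrier → Carrier
  sumR []       = 0#
  sumR (x ∷ xs) = x + sumR xs

  η : ∀ {n} → Character n
  η X h = 1#

  ζ : ∀ {n} → Character n
  ζ {n} X h with all? (λ A → (A ⊆? X) →-dec (h A ≟ˢ A)) (allSubsets n)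
  ... | yes _ = 1#
  ... | no  _ = 0#

  -- convolution, evaluated at the full ground set I = Fin n:
  -- (ψ * ψ')_I(g) = Σ_{S ⊔ T = I, S convex} ψ_S(g|_S) ψ'_T(g/_S)
  conv : ∀ {n} → Character n → Character n → (Subset n → Subset n) → Carrier
  conv {n} ψ ψ' g =
    sumR (map (λ S → ψ S (restrict g S) * ψ' (∁ S) (contract g S))
              (filter (convex? g) (allSubsets n)))

  φ : ∀ {n} → (Subset n → Subset n) → Carrier
  φ = conv ζ η

  φ' : ∀ {n} → (Subset n → Subset n) → Carrier
  φ' = conv η ζ

  fromℕ : ℕ → Carrier
  fromℕ zero    = 0#
  fromℕ (suc k) = 1# + fromℕ k

  record IsField : Set (c Level.⊔ ℓ) where
    field
      nontrivial : ¬ (1# ≈ 0#)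
      inverses   : ∀ x → ¬ (x ≈ 0#) → Σ Carrier (λ y → x * y ≈ 1#)

  CharNot2 : Set ℓ
  CharNot2 = ¬ (1# + 1# ≈ 0#)

-- ζ_S(g|_S) is the indicator of S being totally convex, and totally convex sets
-- are convex, so φ_I(g) counts them. Dually, ζ_{I∖S}(g/_S) is the indicator of
-- I∖S ⊆ Ex(g): if every point outside S is extreme then every superset of S is
-- convex, which makes g/_S discrete; conversely, contracting the coatom I∖{i}
-- shows that each i ∉ S is extreme. Such sets S are convex, and there are
-- 2^ex(g) of them.
module Submission where

open import Defs
open import Level using (0ℓ)
open import Data.Nat using (ℕ; _^_)
open import Data.Fin.Subset using (Subset)
open import Data.Product using (_×_; _,_)
open import Algebra.Bundles using (CommutativeRing)

open import Function using (_∘_)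
open import Data.Bool using (false; true)
open import Data.Empty using (⊥-elim)
open import Data.Nat using (zero; suc; _+_)
open import Data.Nat.Properties using (+-suc; +-identityʳ)
open import Data.Fin using (Fin; zero; suc; _≟_)
import Data.Fin.Properties as Fin
open import Data.Fin.Subset using (_⊆_; _∪_; _∩_; ∁; ⁅_⁆; _∈_; _∉_; ⊤; ⊥)
open import Data.Fin.Subset.Properties
  using ( _∈?_; _⊆?_; ⊆-refl; ⊆-antisym; drop-there; drop-not-there; x∈⁅x⁆; x∈⁅y⁆⇒x≡y
        ; x≢y⇒x∉⁅y⁆; x∈∁p⇒x∉p; x∉p⇒x∈∁p; p∩q⊆p; p∩q⊆q; x∈p∩q⁺; p⊆p∪q; q⊆p∪q; x∈p∪q⁻
        ; ∩-distribʳ-∪; ∩-inverseʳ; ∩-identityʳ; ∪-identityˡ; ∪-distribˡ-∩; ∪-inverseʳ )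
open import Data.Vec.Base using ([]; _∷_)
import Data.Vec.Base as Vec
open import Data.List using (List; []; _∷_; map; concatMap; filter; length; allFin; tabulate)
open import Data.List.Properties using (filter-≐; filter-none; filter-accept; filter-reject)
open import Data.List.Membership.Propositional using () renaming (_∈_ to _∈ₗ_)
open import Data.List.Membership.Propositional.Properties using (∈-concat⁺′; ∈-map⁺)
open import Data.List.Relation.Unary.All as All using (All; all?)
open import Data.List.Relation.Unary.Any using (here; there)
open import Data.Sum using ([_,_])
open import Relation.Binary.PropositionalEquality
  using (_≡_; refl; sym; trans; cong; subst; module ≡-Reasoning)
open import Relation.Nullary using (¬_; Dec; yes; no)
open import Relation.Nullary.Decidable using (¬?; _→-dec_)
open import Relation.Nullary.Negation using (contradiction)
open import Relation.Unary using (Pred; Decidable)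

∈-allSubsets : ∀ {n} (A : Subset n) → A ∈ₗ allSubsets n
∈-allSubsets []          = here refl
∈-allSubsets (false ∷ A) = ∈-concat⁺′ (here refl) (∈-map⁺ _ (∈-allSubsets A))
∈-allSubsets (true ∷ A)  = ∈-concat⁺′ (there (here refl)) (∈-map⁺ _ (∈-allSubsets A))

All-allSubsets : ∀ {n p} {P : Pred (Subset n) p} → All P (allSubsets n) → ∀ A → P A
All-allSubsets ps A = All.lookup ps (∈-allSubsets A)

length-filter-allSubsets-suc :
  ∀ {n p} {P : Pred (Subset (suc n)) p} (P? : Decidable P) →
  length (filter P? (allSubsets (suc n))) ≡
  length (filter (P? ∘ (false ∷_)) (allSubsets n)) + length (filter (P? ∘ (true ∷_)) (allSubsets n))
length-filter-allSubsets-suc P? = go (allSubsets _)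
  where
  go : ∀ L → length (filter P? (concatMap (λ A → (false ∷ A) ∷ (true ∷ A) ∷ []) L)) ≡
             length (filter (P? ∘ (false ∷_)) L) + length (filter (P? ∘ (true ∷_)) L)
  go []      = refl
  go (A ∷ L) with P? (false ∷ A)
  ... | yes _ with P? (true ∷ A)
  ...   | yes _ = cong suc (trans (cong suc (go L)) (sym (+-suc _ _)))
  ...   | no  _ = cong suc (go L)
  go (A ∷ L) | no _ with P? (true ∷ A)
  ...   | yes _ = trans (cong suc (go L)) (sym (+-suc _ _))
  ...   | no  _ = go L

length-filter-tabulate : ∀ {a p} {A : Set a} {P : Pred A p} (P? : Decidable P) {m} (f : Fin m → A) →
                         length (filter P? (tabulate f)) ≡ length (filter (P? ∘ f) (allFin m))
length-filter-tabulate P? {zero}  f = refl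
length-filter-tabulate P? {suc m} f with P? (f zero)
... | yes _ = cong suc (trans (length-filter-tabulate P? (f ∘ suc)) (sym (length-filter-tabulate (P? ∘ f) suc)))
... | no  _ = trans (length-filter-tabulate P? (f ∘ suc)) (sym (length-filter-tabulate (P? ∘ f) suc))

_∁⊆_ : ∀ {n p} → Subset n → Pred (Fin n) p → Set p
S ∁⊆ P = ∀ i → i ∉ S → P i

_∁⊆?_ : ∀ {n p} {P : Pred (Fin n) p} (S : Subset n) → Decidable P → Dec (S ∁⊆ P)
S ∁⊆? P? = Fin.all? (λ i → ¬? (i ∈? S) →-dec P? i)

module _ {n p} {P : Pred (Fin (suc n)) p} where

  ∷-∁⊆⁻ : ∀ {b A} → (b ∷ A) ∁⊆ P → A ∁⊆ (P ∘ suc)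
  ∷-∁⊆⁻ h i i∉A = h (suc i) (i∉A ∘ drop-there)

  true∷-∁⊆⁺ : ∀ {A} → A ∁⊆ (P ∘ suc) → (true ∷ A) ∁⊆ P
  true∷-∁⊆⁺ h zero    0∉ = ⊥-elim (0∉ Vec.here)
  true∷-∁⊆⁺ h (suc i) i∉ = h i (drop-not-there i∉)

  false∷-∁⊆⁺ : ∀ {A} → P zero → A ∁⊆ (P ∘ suc) → (false ∷ A) ∁⊆ P
  false∷-∁⊆⁺ P0 h zero    _  = P0
  false∷-∁⊆⁺ P0 h (suc i) i∉ = h i (drop-not-there i∉)

count-∁⊆ : ∀ {n p} {P : Pred (Fin n) p} (P? : Decidable P) →
           length (filter (_∁⊆? P?) (allSubsets n)) ≡ 2 ^ length (filter P? (allFin n))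
count-∁⊆ {zero}      P? = refl
count-∁⊆ {suc n} {P = P} P? = begin
  length (filter (_∁⊆? P?) (allSubsets (suc n)))  ≡⟨ length-filter-allSubsets-suc (_∁⊆? P?) ⟩
  #false∷ + #true∷                                ≡⟨ cong (#false∷ +_) #true∷≡N ⟩
  #false∷ + N                                     ≡⟨ by-cases (P? zero) ⟩
  2 ^ length (filter P? (allFin (suc n)))         ∎
  where
  open ≡-Reasoning
  L : List (Subset n)
  L = allSubsets n
  #false∷ #true∷ N k : ℕ
  #false∷ = length (filter (λ A → (false ∷ A) ∁⊆? P?) L)
  #true∷  = length (filter (λ A → (true ∷ A) ∁⊆? P?) L)
  N       = length (filter (_∁⊆? (P? ∘ suc)) L)
  k       = length (filter (P? ∘ suc) (allFin n))

  #true∷≡N : #true∷ ≡ N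
  #true∷≡N = cong length (filter-≐ _ _ (∷-∁⊆⁻ , true∷-∁⊆⁺) L)

  N≡2^k : N ≡ 2 ^ k
  N≡2^k = count-∁⊆ (P? ∘ suc)

  count-tail : length (filter P? (tabulate suc)) ≡ k
  count-tail = length-filter-tabulate P? suc

  by-cases : Dec (P zero) → #false∷ + N ≡ 2 ^ length (filter P? (allFin (suc n)))
  by-cases (yes P0) = begin
    #false∷ + N    ≡⟨ cong (_+ N) (cong length (filter-≐ _ _ (∷-∁⊆⁻ , false∷-∁⊆⁺ P0) L)) ⟩
    N + N          ≡⟨ cong (λ m → m + m) N≡2^k ⟩
    2 ^ k + 2 ^ k  ≡⟨ cong (2 ^ k +_) (sym (+-identityʳ (2 ^ k))) ⟩
    2 ^ suc k      ≡⟨ cong (λ m → 2 ^ suc m) (sym count-tail) ⟩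
    2 ^ length (zero ∷ filter P? (tabulate suc)) ≡⟨ cong (λ xs → 2 ^ length xs) (sym (filter-accept P? P0)) ⟩
    2 ^ length (filter P? (allFin (suc n)))      ∎
  by-cases (no ¬P0) = begin
    #false∷ + N    ≡⟨ cong (λ xs → length xs + N) (filter-none (λ A → (false ∷ A) ∁⊆? P?) {L} (All.tabulate λ _ h → ¬P0 (h zero λ ()))) ⟩
    N              ≡⟨ N≡2^k ⟩
    2 ^ k          ≡⟨ cong (2 ^_) (sym count-tail) ⟩
    2 ^ length (filter P? (tabulate suc))   ≡⟨ cong (λ xs → 2 ^ length xs) (sym (filter-reject P? ¬P0)) ⟩
    2 ^ length (filter P? (allFin (suc n))) ∎

p⊆q⇒p∩q≡p : ∀ {n} {p q : Subset n} → p ⊆ q → p ∩ q ≡ p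
p⊆q⇒p∩q≡p {p = p} {q} p⊆q = ⊆-antisym (p∩q⊆p p q) (λ x∈p → x∈p∩q⁺ (x∈p , p⊆q x∈p))

p⊆q⇒p∪q≡q : ∀ {n} {p q : Subset n} → p ⊆ q → p ∪ q ≡ q
p⊆q⇒p∪q≡q {p = p} {q} p⊆q = ⊆-antisym (λ x∈ → [ p⊆q , (λ x∈q → x∈q) ] (x∈p∪q⁻ p q x∈)) (q⊆p∪q p q)

q⊆∁p⇒[p∪q]∩∁p≡q : ∀ {n} (p q : Subset n) → q ⊆ ∁ p → (p ∪ q) ∩ ∁ p ≡ q
q⊆∁p⇒[p∪q]∩∁p≡q p q q⊆∁p = begin
  (p ∪ q) ∩ ∁ p          ≡⟨ ∩-distribʳ-∪ (∁ p) p q ⟩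
  (p ∩ ∁ p) ∪ (q ∩ ∁ p)  ≡⟨ cong (_∪ (q ∩ ∁ p)) (∩-inverseʳ p) ⟩
  ⊥ ∪ (q ∩ ∁ p)          ≡⟨ ∪-identityˡ (q ∩ ∁ p) ⟩
  q ∩ ∁ p                ≡⟨ p⊆q⇒p∩q≡p q⊆∁p ⟩
  q                      ∎
  where open ≡-Reasoning

p⊆q⇒p∪[q∩∁p]≡q : ∀ {n} (p q : Subset n) → p ⊆ q → p ∪ (q ∩ ∁ p) ≡ q
p⊆q⇒p∪[q∩∁p]≡q p q p⊆q = begin
  p ∪ (q ∩ ∁ p)          ≡⟨ ∪-distribˡ-∩ p q (∁ p) ⟩
  (p ∪ q) ∩ (p ∪ ∁ p)    ≡⟨ cong ((p ∪ q) ∩_) (∪-inverseʳ p) ⟩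
  (p ∪ q) ∩ ⊤            ≡⟨ ∩-identityʳ (p ∪ q) ⟩
  p ∪ q                  ≡⟨ p⊆q⇒p∪q≡q p⊆q ⟩
  q                      ∎
  where open ≡-Reasoning

x∉p⇒p⊆∁⁅x⁆ : ∀ {n} {x : Fin n} {p : Subset n} → x ∉ p → p ⊆ ∁ ⁅ x ⁆
x∉p⇒p⊆∁⁅x⁆ {x = x} {p} x∉p y∈p = x∉p⇒x∈∁p (λ y∈⁅x⁆ → x∉p (subst (_∈ p) (x∈⁅y⁆⇒x≡y x y∈⁅x⁆) y∈p))

Extreme : ∀ {n} → (Subset n → Subset n) → Pred (Fin n) 0ℓ
Extreme g x = g (∁ ⁅ x ⁆) ≡ ∁ ⁅ x ⁆

extreme? : ∀ {n} (g : Subset n → Subset n) → Decidable (Extreme g)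
extreme? g x = g (∁ ⁅ x ⁆) ≟ˢ ∁ ⁅ x ⁆

module ClosureOperator {n} {g : Subset n → Subset n}
  (extensive : ∀ A → A ⊆ g A) (monotone : ∀ A B → A ⊆ B → g A ⊆ g B) where

  ∁⊆Ex⇒convex : ∀ S → S ∁⊆ Extreme g → g S ≡ S
  ∁⊆Ex⇒convex S ext = ⊆-antisym gS⊆S (extensive S)
    where
    gS⊆S : g S ⊆ S
    gS⊆S {y} y∈gS with y ∈? S
    ... | yes y∈S = y∈S
    ... | no  y∉S = contradiction (x∈⁅x⁆ y) (x∈∁p⇒x∉p y∈∁⁅y⁆)
      where
      y∈∁⁅y⁆ : y ∈ ∁ ⁅ y ⁆
      y∈∁⁅y⁆ = subst (y ∈_) (ext y y∉S) (monotone S _ (x∉p⇒p⊆∁⁅x⁆ y∉S) y∈gS)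

  ∁⊆Ex⇒totallyConvex-contract : ∀ S → S ∁⊆ Extreme g → TotallyConvex (contract g S) (∁ S)
  ∁⊆Ex⇒totallyConvex-contract S ext A A⊆∁S = begin
    g (S ∪ A) ∩ ∁ S  ≡⟨ cong (_∩ ∁ S) (∁⊆Ex⇒convex (S ∪ A) (λ x x∉S∪A → ext x (x∉S∪A ∘ p⊆p∪q A))) ⟩
    (S ∪ A) ∩ ∁ S    ≡⟨ q⊆∁p⇒[p∪q]∩∁p≡q S A A⊆∁S ⟩
    A                ∎
    where open ≡-Reasoning

  totallyConvex-contract⇒∁⊆Ex : ∀ S → TotallyConvex (contract g S) (∁ S) → S ∁⊆ Extreme g
  totallyConvex-contract⇒∁⊆Ex S discrete i i∉S = ⊆-antisym g∁⁅i⁆⊆∁⁅i⁆ (extensive (∁ ⁅ i ⁆))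
    where
    trace : g (∁ ⁅ i ⁆) ∩ ∁ S ≡ ∁ ⁅ i ⁆ ∩ ∁ S
    trace = subst (λ T → g T ∩ ∁ S ≡ ∁ ⁅ i ⁆ ∩ ∁ S)
                  (p⊆q⇒p∪[q∩∁p]≡q S (∁ ⁅ i ⁆) (x∉p⇒p⊆∁⁅x⁆ i∉S))
                  (discrete (∁ ⁅ i ⁆ ∩ ∁ S) (p∩q⊆q _ _))
    g∁⁅i⁆⊆∁⁅i⁆ : g (∁ ⁅ i ⁆) ⊆ ∁ ⁅ i ⁆
    g∁⁅i⁆⊆∁⁅i⁆ {y} y∈ with y ≟ i
    ... | no  y≢i = x∉p⇒x∈∁p (x≢y⇒x∉⁅y⁆ y≢i)
    ... | yes refl = contradiction (x∈⁅x⁆ y)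
                       (x∈∁p⇒x∉p (p∩q⊆p _ _ (subst (y ∈_) trace (x∈p∩q⁺ (y∈ , x∉p⇒x∈∁p i∉S)))))

module Counting {c ℓ} (R : CommutativeRing c ℓ) where
  open CommutativeRing R renaming (refl to ≈-refl; trans to ≈-trans)
  open Characters R

  sumR-indicator : ∀ {a p q} {A : Set a} {C : Pred A p} {P : Pred A q}
                   (C? : Decidable C) (P? : Decidable P) {f : A → Carrier} →
                   (∀ {x} → P x → C x) → (∀ {x} → P x → f x ≈ 1#) → (∀ {x} → ¬ P x → f x ≈ 0#) →
                   ∀ L → sumR (map f (filter C? L)) ≈ fromℕ (length (filter P? L))
  sumR-indicator C? P? P⇒C f≈1 f≈0 []      = ≈-refl
  sumR-indicator C? P? P⇒C f≈1 f≈0 (x ∷ L) with C? x | P? x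
  ... | yes _ | yes Px = +-cong (f≈1 Px) (sumR-indicator C? P? P⇒C f≈1 f≈0 L)
  ... | yes _ | no ¬Px = ≈-trans (+-cong (f≈0 ¬Px) (sumR-indicator C? P? P⇒C f≈1 f≈0 L)) (+-identityˡ _)
  ... | no ¬Cx | yes Px = contradiction (P⇒C Px) ¬Cx
  ... | no _  | no _   = sumR-indicator C? P? P⇒C f≈1 f≈0 L

  ζ-discrete : ∀ {n} {X : Subset n} {h : Subset n → Subset n} → TotallyConvex h X → ζ X h ≈ 1#
  ζ-discrete {n} {X} {h} discrete with all? (λ A → (A ⊆? X) →-dec (h A ≟ˢ A)) (allSubsets n)
  ... | yes _ = ≈-refl
  ... | no ¬all = contradiction (All.tabulate λ {A} _ → discrete A) ¬all

  ζ-nondiscrete : ∀ {n} {X : Subset n} {h : Subset n → Subset n} → ¬ TotallyConvex h X → ζ X h ≈ 0#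
  ζ-nondiscrete {n} {X} {h} ¬discrete with all? (λ A → (A ⊆? X) →-dec (h A ≟ˢ A)) (allSubsets n)
  ... | yes all = contradiction (All-allSubsets all) ¬discrete
  ... | no _    = ≈-refl

  φ≈numTotallyConvex : ∀ {n} (g : Subset n → Subset n) → φ g ≈ fromℕ (numTotallyConvex g)
  φ≈numTotallyConvex {n} g =
    sumR-indicator (convex? g) (totallyConvex? g)
      (λ tc → All-allSubsets tc _ ⊆-refl)
      (λ tc → ≈-trans (*-identityʳ _) (ζ-discrete (All-allSubsets tc)))
      (λ ¬tc → ≈-trans (*-identityʳ _) (ζ-nondiscrete λ tc → ¬tc (All.tabulate λ {A} _ → tc A)))
      (allSubsets n)

  φ'≈2^ex : ∀ {n} {g : Subset n → Subset n} →
            (∀ A → A ⊆ g A) → (∀ A B → A ⊆ B → g A ⊆ g B) → φ' g ≈ fromℕ (2 ^ ex g)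
  φ'≈2^ex {n} {g} extensive monotone = ≈-trans
    (sumR-indicator (convex? g) (_∁⊆? extreme? g)
      (∁⊆Ex⇒convex _)
      (λ ext → ≈-trans (*-identityˡ _) (ζ-discrete (∁⊆Ex⇒totallyConvex-contract _ ext)))
      (λ ¬ext → ≈-trans (*-identityˡ _) (ζ-nondiscrete (¬ext ∘ totallyConvex-contract⇒∁⊆Ex _)))
      (allSubsets n))
    (reflexive (cong fromℕ (count-∁⊆ (extreme? g))))
    where open ClosureOperator extensive monotone

mainTheorem11 : ∀ {c ℓ} (R : CommutativeRing c ℓ) →
                Characters.IsField R → Characters.CharNot2 R →
                (n : ℕ) (g : Subset n → Subset n) → IsConvexGeometry g →
                let open CommutativeRing R using (_≈_) in
                (Characters.φ R g ≈ Characters.fromℕ R (numTotallyConvex g))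
                × (Characters.φ' R g ≈ Characters.fromℕ R (2 ^ ex g))
mainTheorem11 R _ _ n g cg = φ≈numTotallyConvex g , φ'≈2^ex extensive monotone
  where
  open Counting R
  open IsConvexGeometry cg
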